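{- For all packed words $u,v,w$ with $v\ne\varepsilon$, $u\triangleleft_R(v\odot w)=(u\triangleleft_R v)\odot w$.
   Context: Words over positive integers; $|w|$ length, $\max(w)$ largest letter ($\max(\varepsilon)=0$), $w^{[k]}$ adds $k$ to every letter. Packed: every integer $1..\max(w)$ occurs. $u\odot v=u^{[\max(v)]}\cdot v$. For packed $w$ of length $n$, $p\ge1$, $I=\{i_1<\dots<i_p\}\subseteq\{1..n+p\}$, $\phi_I(w)$ is the word of length $n+p$ with letter $\max(w)+1$ at positions of $I$ and the letters of $w$ in order elsewhere; each nonempty packed $v$ is uniquely $\phi_I(v')$. For packed $u$ and nonempty packed $v=\phi_I(v')$, $u\triangleleft_R v=\phi_{I+|u|}(u\odot v')$ with $I+|u|=\{i+|u|:i\in I\}$. -}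

module Defs where

open import Data.Nat using (ℕ; zero; suc; _+_; _≤_; _⊔_; _≡ᵇ_)
open import Data.Bool using (Bool; true; false; not)
open import Data.List using (List; []; _∷_; _++_; map; foldr; length; filter; replicate)
open import Data.List.Relation.Unary.All using (All)
open import Data.List.Membership.Propositional using (_∈_)
open import Relation.Nullary.Decidable using (¬?)
open import Data.Nat.Properties using (_≟_)

-- Words over positive integers are lists of naturals (positivity is part of Packed).
Word : Set
Word = List ℕ

maxW : Word → ℕ
maxW = foldr _⊔_ 0

shift : ℕ → Word → Word
shift k = map (k +_)

Packed : Word → Set
Packed w = All (λ x → 1 ≤ x) w × (∀ k → 1 ≤ k → k ≤ maxW w → k ∈ w)
  where open import Data.Product using (_×_)

_⊙_ : Word → Word → Word
u ⊙ v = shift (maxW v) u ++ v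

-- A subset I ⊆ {1..N} is represented by its indicator list of length N
-- (position i is true iff i ∈ I).  phiAux c I w writes letter c at the
-- positions of I and the letters of w in order elsewhere.
phiAux : ℕ → List Bool → Word → Word
phiAux c []            w       = []
phiAux c (true  ∷ bs)  w       = c ∷ phiAux c bs w
phiAux c (false ∷ bs)  []      = []
phiAux c (false ∷ bs)  (x ∷ w) = x ∷ phiAux c bs w

phi : List Bool → Word → Word
phi I w = phiAux (suc (maxW w)) I w

-- The unique decomposition v = φ_I(v') of a nonempty packed word:
-- I = positions of the letter max(v), v' = v with those letters deleted.
decI : Word → List Bool
decI v = map (λ x → x ≡ᵇ maxW v) v

decW : Word → Word
decW v = filter (λ x → ¬? (x ≟ maxW v)) v

shiftI : ℕ → List Bool → List Bool
shiftI k I = replicate k false ++ I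

_◁R_ : Word → Word → Word
u ◁R v = phi (shiftI (length u) (decI v)) (u ⊙ decW v)

{-# OPTIONS --safe #-}
module Submission where

open import Defs
open import Data.Bool using (Bool; true; false)
open import Data.List using (List; []; _∷_; _++_; map; filter; length; replicate)
open import Data.List.Properties using (++-assoc; map-++; filter-++; length-++; length-map)
open import Data.List.Relation.Unary.All as All using (All; _∷_)
open import Data.Nat using (ℕ; zero; suc; _+_; _≤_; _<_; _⊔_; _≡ᵇ_; s≤s)
open import Data.Nat.Properties
open import Data.Product using (_,_)
open import Relation.Binary.PropositionalEquality
  using (_≡_; _≢_; refl; sym; trans; cong; cong₂; module ≡-Reasoning)
open import Relation.Nullary using (contradiction)
open import Relation.Nullary.Decidable using (¬?)

-- A packed word v = φ_I(v') splits at the maximal letter: v ⊙ w has maximal letter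
-- max w + max v, so decomposing it marks exactly the marked positions of v and deletes
-- the same letters, i.e. I(v ⊙ w) = I(v) followed by |w| unmarked positions and
-- (v ⊙ w)' = v' ⊙ w.  Since ⊙ is associative and φ commutes with shifting and with
-- appending an unmarked suffix, u ◁R (v ⊙ w) = φ_{I+|u|}((u ⊙ v') ⊙ w) = (u ◁R v) ⊙ w.
-- Packedness is only needed for max v ≥ 1, which keeps the letters of w below the
-- maximum of v ⊙ w.

freeSlots : List Bool → ℕ
freeSlots []           = 0
freeSlots (true  ∷ bs) = freeSlots bs
freeSlots (false ∷ bs) = suc (freeSlots bs)

freeSlots-++ : ∀ I J → freeSlots (I ++ J) ≡ freeSlots I + freeSlots J
freeSlots-++ []           J = refl
freeSlots-++ (true  ∷ I) J = freeSlots-++ I J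
freeSlots-++ (false ∷ I) J = cong suc (freeSlots-++ I J)

freeSlots-replicate-false : ∀ k → freeSlots (replicate k false) ≡ k
freeSlots-replicate-false zero    = refl
freeSlots-replicate-false (suc k) = cong suc (freeSlots-replicate-false k)

phiAux-++ : ∀ c I J x y → freeSlots I ≡ length x →
            phiAux c (I ++ J) (x ++ y) ≡ phiAux c I x ++ phiAux c J y
phiAux-++ c []          J []      y _  = refl
phiAux-++ c []          J (_ ∷ _) y ()
phiAux-++ c (true  ∷ I) J x       y eq = cong (c ∷_) (phiAux-++ c I J x y eq)
phiAux-++ c (false ∷ I) J []      y ()
phiAux-++ c (false ∷ I) J (a ∷ x) y eq = cong (a ∷_) (phiAux-++ c I J x y (suc-injective eq))

phiAux-replicate-false : ∀ c y → phiAux c (replicate (length y) false) y ≡ y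
phiAux-replicate-false c []      = refl
phiAux-replicate-false c (a ∷ y) = cong (a ∷_) (phiAux-replicate-false c y)

phiAux-shift : ∀ m c I x → phiAux (m + c) I (shift m x) ≡ shift m (phiAux c I x)
phiAux-shift m c []          x       = refl
phiAux-shift m c (true  ∷ I) x       = cong ((m + c) ∷_) (phiAux-shift m c I x)
phiAux-shift m c (false ∷ I) []      = refl
phiAux-shift m c (false ∷ I) (a ∷ x) = cong ((m + a) ∷_) (phiAux-shift m c I x)

shift-+ : ∀ m d u → shift (m + d) u ≡ shift m (shift d u)
shift-+ m d []      = refl
shift-+ m d (a ∷ u) = cong₂ _∷_ (+-assoc m d a) (shift-+ m d u)

maxW-++ : ∀ x y → maxW (x ++ y) ≡ maxW x ⊔ maxW y
maxW-++ []      y = refl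
maxW-++ (a ∷ x) y = trans (cong (a ⊔_) (maxW-++ x y)) (sym (⊔-assoc a (maxW x) (maxW y)))

maxW-shift-⊔ : ∀ m x → maxW (shift m x) ⊔ m ≡ m + maxW x
maxW-shift-⊔ m []      = trans (⊔-identityˡ m) (sym (+-identityʳ m))
maxW-shift-⊔ m (a ∷ x) = begin
  ((m + a) ⊔ maxW (shift m x)) ⊔ m ≡⟨ ⊔-assoc (m + a) _ m ⟩
  (m + a) ⊔ (maxW (shift m x) ⊔ m) ≡⟨ cong ((m + a) ⊔_) (maxW-shift-⊔ m x) ⟩
  (m + a) ⊔ (m + maxW x)           ≡⟨ sym (+-distribˡ-⊔ m a (maxW x)) ⟩
  m + (a ⊔ maxW x)                 ∎
  where open ≡-Reasoning

-- The shifted left factor dominates max w, which absorbs the right factor.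
maxW-⊙ : ∀ x w → maxW (x ⊙ w) ≡ maxW w + maxW x
maxW-⊙ x w = trans (maxW-++ (shift (maxW w) x) w) (maxW-shift-⊔ (maxW w) x)

⊙-assoc : ∀ u v w → u ⊙ (v ⊙ w) ≡ (u ⊙ v) ⊙ w
⊙-assoc u v w = begin
  shift (maxW (v ⊙ w)) u ++ (shift m v ++ w)  ≡⟨ cong (λ k → shift k u ++ (shift m v ++ w)) (maxW-⊙ v w) ⟩
  shift (m + maxW v) u ++ (shift m v ++ w)    ≡⟨ cong (_++ (shift m v ++ w)) (shift-+ m (maxW v) u) ⟩
  shift m (shift (maxW v) u) ++ (shift m v ++ w) ≡⟨ sym (++-assoc (shift m (shift (maxW v) u)) (shift m v) w) ⟩
  (shift m (shift (maxW v) u) ++ shift m v) ++ w ≡⟨ cong (_++ w) (sym (map-++ (m +_) (shift (maxW v) u) v)) ⟩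
  (u ⊙ v) ⊙ w                                  ∎
  where
  open ≡-Reasoning
  m = maxW w

phi-⊙ : ∀ I x w → freeSlots I ≡ length x →
        phi (I ++ replicate (length w) false) (x ⊙ w) ≡ phi I x ⊙ w
phi-⊙ I x w eq = begin
  phiAux (suc (maxW (x ⊙ w))) (I ++ F) (shift m x ++ w)
    ≡⟨ cong (λ c → phiAux c (I ++ F) (shift m x ++ w)) c≡m+c′ ⟩
  phiAux (m + c′) (I ++ F) (shift m x ++ w)
    ≡⟨ phiAux-++ (m + c′) I F (shift m x) w (trans eq (sym (length-map (m +_) x))) ⟩
  phiAux (m + c′) I (shift m x) ++ phiAux (m + c′) F w
    ≡⟨ cong₂ _++_ (phiAux-shift m c′ I x) (phiAux-replicate-false (m + c′) w) ⟩
  phi I x ⊙ w ∎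
  where
  open ≡-Reasoning
  m  = maxW w
  c′ = suc (maxW x)
  F  = replicate (length w) false
  c≡m+c′ : suc (maxW (x ⊙ w)) ≡ m + c′
  c≡m+c′ = trans (cong suc (maxW-⊙ x w)) (sym (+-suc m (maxW x)))

markAll : ℕ → Word → List Bool
markAll K = map (_≡ᵇ K)

deleteAll : ℕ → Word → Word
deleteAll K = filter (λ x → ¬? (x ≟ K))

≡ᵇ-+-cancelˡ : ∀ m x K → (m + x ≡ᵇ m + K) ≡ (x ≡ᵇ K)
≡ᵇ-+-cancelˡ zero    x K = refl
≡ᵇ-+-cancelˡ (suc m) x K = ≡ᵇ-+-cancelˡ m x K

<⇒≡ᵇ-false : ∀ {x K} → x < K → (x ≡ᵇ K) ≡ false
<⇒≡ᵇ-false {zero}  {suc K} _       = refl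
<⇒≡ᵇ-false {suc x} {suc K} (s≤s p) = <⇒≡ᵇ-false p

markAll-shift : ∀ m K v → markAll (m + K) (shift m v) ≡ markAll K v
markAll-shift m K []      = refl
markAll-shift m K (x ∷ v) = cong₂ _∷_ (≡ᵇ-+-cancelˡ m x K) (markAll-shift m K v)

markAll-below : ∀ K w → All (_< K) w → markAll K w ≡ replicate (length w) false
markAll-below K []      _        = refl
markAll-below K (x ∷ w) (p ∷ ps) = cong₂ _∷_ (<⇒≡ᵇ-false p) (markAll-below K w ps)

deleteAll-shift : ∀ m K v → deleteAll (m + K) (shift m v) ≡ shift m (deleteAll K v)
deleteAll-shift m K []      = refl
deleteAll-shift m K (x ∷ v) rewrite ≡ᵇ-+-cancelˡ m x K with x ≡ᵇ K
... | true  = deleteAll-shift m K v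
... | false = cong ((m + x) ∷_) (deleteAll-shift m K v)

deleteAll-below : ∀ K w → All (_< K) w → deleteAll K w ≡ w
deleteAll-below K []      _        = refl
deleteAll-below K (x ∷ w) (p ∷ ps) rewrite <⇒≡ᵇ-false p = cong (x ∷_) (deleteAll-below K w ps)

freeSlots-markAll : ∀ K v → freeSlots (markAll K v) ≡ length (deleteAll K v)
freeSlots-markAll K []      = refl
freeSlots-markAll K (x ∷ v) with x ≡ᵇ K
... | true  = freeSlots-markAll K v
... | false = cong suc (freeSlots-markAll K v)

all-≤-maxW : ∀ w → All (_≤ maxW w) w
all-≤-maxW []      = All.[]
all-≤-maxW (a ∷ w) =
  m≤m⊔n a (maxW w) ∷ All.map (λ p → ≤-trans p (m≤n⊔m a (maxW w))) (all-≤-maxW w)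

all-<-maxW-⊙ : ∀ v w → 1 ≤ maxW v → All (_< maxW (v ⊙ w)) w
all-<-maxW-⊙ v w 1≤M rewrite maxW-⊙ v w =
  All.map (λ p → ≤-<-trans p (m<m+n (maxW w) 1≤M)) (all-≤-maxW w)

decI-⊙ : ∀ v w → 1 ≤ maxW v → decI (v ⊙ w) ≡ decI v ++ replicate (length w) false
decI-⊙ v w 1≤M = begin
  markAll (maxW (v ⊙ w)) (shift m v ++ w)
    ≡⟨ map-++ _ (shift m v) w ⟩
  markAll (maxW (v ⊙ w)) (shift m v) ++ markAll (maxW (v ⊙ w)) w
    ≡⟨ cong (λ K → markAll K (shift m v) ++ markAll (maxW (v ⊙ w)) w) (maxW-⊙ v w) ⟩
  markAll (m + maxW v) (shift m v) ++ markAll (maxW (v ⊙ w)) w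
    ≡⟨ cong₂ _++_ (markAll-shift m (maxW v) v) (markAll-below _ w (all-<-maxW-⊙ v w 1≤M)) ⟩
  decI v ++ replicate (length w) false ∎
  where
  open ≡-Reasoning
  m = maxW w

decW-⊙ : ∀ v w → 1 ≤ maxW v → decW (v ⊙ w) ≡ decW v ⊙ w
decW-⊙ v w 1≤M = begin
  deleteAll (maxW (v ⊙ w)) (shift m v ++ w)
    ≡⟨ filter-++ _ (shift m v) w ⟩
  deleteAll (maxW (v ⊙ w)) (shift m v) ++ deleteAll (maxW (v ⊙ w)) w
    ≡⟨ cong (λ K → deleteAll K (shift m v) ++ deleteAll (maxW (v ⊙ w)) w) (maxW-⊙ v w) ⟩
  deleteAll (m + maxW v) (shift m v) ++ deleteAll (maxW (v ⊙ w)) w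
    ≡⟨ cong₂ _++_ (deleteAll-shift m (maxW v) v) (deleteAll-below _ w (all-<-maxW-⊙ v w 1≤M)) ⟩
  decW v ⊙ w ∎
  where
  open ≡-Reasoning
  m = maxW w

freeSlots-◁R : ∀ u v → freeSlots (shiftI (length u) (decI v)) ≡ length (u ⊙ decW v)
freeSlots-◁R u v = begin
  freeSlots (R ++ decI v)                         ≡⟨ freeSlots-++ R (decI v) ⟩
  freeSlots R + freeSlots (decI v)                ≡⟨ cong₂ _+_ (freeSlots-replicate-false (length u)) (freeSlots-markAll (maxW v) v) ⟩
  length u + length (decW v)                      ≡⟨ cong (_+ length (decW v)) (sym (length-map (maxW (decW v) +_) u)) ⟩
  length (shift (maxW (decW v)) u) + length (decW v) ≡⟨ sym (length-++ (shift (maxW (decW v)) u)) ⟩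
  length (u ⊙ decW v)                             ∎
  where
  open ≡-Reasoning
  R = replicate (length u) false

Packed⇒1≤maxW : ∀ v → Packed v → v ≢ [] → 1 ≤ maxW v
Packed⇒1≤maxW []      _             v≢[] = contradiction refl v≢[]
Packed⇒1≤maxW (a ∷ v) (1≤a ∷ _ , _) _    = ≤-trans 1≤a (m≤m⊔n a (maxW v))

mainTheorem16 : (u v w : Word) → Packed u → Packed v → Packed w → v ≢ []
    → u ◁R (v ⊙ w) ≡ (u ◁R v) ⊙ w
mainTheorem16 u v w _ pv _ v≢[] = begin
  phi (R ++ decI (v ⊙ w)) (u ⊙ decW (v ⊙ w))
    ≡⟨ cong₂ (λ I x → phi (R ++ I) (u ⊙ x)) (decI-⊙ v w 1≤M) (decW-⊙ v w 1≤M) ⟩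
  phi (R ++ (decI v ++ F)) (u ⊙ (decW v ⊙ w))
    ≡⟨ cong₂ phi (sym (++-assoc R (decI v) F)) (⊙-assoc u (decW v) w) ⟩
  phi ((R ++ decI v) ++ F) ((u ⊙ decW v) ⊙ w)
    ≡⟨ phi-⊙ (R ++ decI v) (u ⊙ decW v) w (freeSlots-◁R u v) ⟩
  (u ◁R v) ⊙ w ∎
  where
  open ≡-Reasoning
  R = replicate (length u) false
  F = replicate (length w) false
  1≤M = Packed⇒1≤maxW v pv v≢[]
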